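{- Let $F$ be a nonempty graph without isolated vertices. Then (i) $\mathrm{ex}_F(n,P_3)\sim \frac{n}{v(F)}$ as $n\to\infty$; (ii) $\mathrm{ex}_F(n,P_4)\ge \left\lfloor \frac{n-\alpha(F)}{v(F)-\alpha(F)}\right\rfloor$; (iii) for an integer $t\ge 3$, if $q$ is the smallest integer such that $K_q$ contains $t-2$ pairwise edge-disjoint copies of $F$, then $\mathrm{ex}_F(n,P_t)\ge \lfloor n/q\rfloor (t-2)$.
   Context: All graphs are simple; $v(F)$ is the number of vertices and $\alpha(F)$ the independence number of $F$; $P_t$ denotes the path on $t$ vertices. $\mathrm{ex}_F(n,G)$ is the maximum $k$ such that there exist $k$ pairwise edge-disjoint subgraphs $F_1,\dots,F_k$ of $K_n$, each isomorphic to $F$, such that $\bigcup_i F_i$ contains no subgraph $G'$ isomorphic to $G$ with $|E(G')\cap E(F_i)|\le 1$ for every $i$. -}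

module Defs where

open import Data.Nat using (ℕ; zero; suc; _+_; _*_; _∸_; _≤_; _<_)
open import Data.Nat.DivMod using (_/_)
open import Data.Fin using (Fin; toℕ)
open import Data.Product using (Σ; _×_; _,_; ∃; ∃-syntax)
open import Data.Sum using (_⊎_; inj₁; inj₂)
open import Data.Empty using (⊥)
open import Relation.Nullary using (¬_)
open import Relation.Binary.PropositionalEquality using (_≡_; _≢_; sym; refl)
open import Function.Definitions using (Injective)

record Graph : Set₁ where
  field
    v     : ℕ
    Adj   : Fin v → Fin v → Set
    symm  : ∀ {x y} → Adj x y → Adj y x
    irrefl : ∀ {x} → ¬ Adj x x
open Graph public

NonemptyGraph : Graph → Set
NonemptyGraph F = Σ (Fin (v F)) λ x → Σ (Fin (v F)) λ y → Adj F x y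

NoIsolated : Graph → Set
NoIsolated F = (x : Fin (v F)) → Σ (Fin (v F)) λ y → Adj F x y

suc-irr : ∀ {m} → suc m ≡ m → ⊥
suc-irr {zero} ()
suc-irr {suc m} e = suc-irr (suc-inj e)
  where
    suc-inj : ∀ {a b} → suc a ≡ suc b → a ≡ b
    suc-inj refl = refl

PathAdj : (t : ℕ) → Fin t → Fin t → Set
PathAdj t i j = (suc (toℕ i) ≡ toℕ j) ⊎ (suc (toℕ j) ≡ toℕ i)

P : ℕ → Graph
P t = record
  { v = t
  ; Adj = PathAdj t
  ; symm = λ { (inj₁ e) → inj₂ e ; (inj₂ e) → inj₁ e }
  ; irrefl = λ { (inj₁ e) → suc-irr e ; (inj₂ e) → suc-irr e }
  }

-- A copy of F in K_n: an injective map of the vertices of F into Fin n.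
-- (The copy is the subgraph of K_n with image vertices and image edges.)
record Copy (F : Graph) (n : ℕ) : Set where
  field
    emb : Fin (v F) → Fin n
    inj : Injective _≡_ _≡_ emb
open Copy public

EdgeIn : ∀ {F n} → Copy F n → Fin n → Fin n → Set
EdgeIn {F} C a b =
  Σ (Fin (v F)) λ x → Σ (Fin (v F)) λ y →
    Adj F x y × emb C x ≡ a × emb C y ≡ b

EdgeDisjoint : ∀ {F n k} → (Fin k → Copy F n) → Set
EdgeDisjoint {n = n} {k} Fs =
  (i j : Fin k) → i ≢ j → (a b : Fin n) → EdgeIn (Fs i) a b → ¬ EdgeIn (Fs j) a b

SamePair : ∀ {n} → Fin n → Fin n → Fin n → Fin n → Set
SamePair a b c d = (a ≡ c × b ≡ d) ⊎ (a ≡ d × b ≡ c)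

Rainbowish : ∀ {F n k} → (Fin k → Copy F n) → (G : Graph) → Set
Rainbowish {F} {n} {k} Fs G =
  Σ (Copy G n) λ H →
    ((x y : Fin (v G)) → Adj G x y →
       Σ (Fin k) λ i → EdgeIn (Fs i) (emb H x) (emb H y))
    ×
    ((i : Fin k) (x y x' y' : Fin (v G)) → Adj G x y → Adj G x' y' →
       EdgeIn (Fs i) (emb H x) (emb H y) → EdgeIn (Fs i) (emb H x') (emb H y') →
       SamePair (emb H x) (emb H y) (emb H x') (emb H y'))

Admissible : Graph → Graph → ℕ → ℕ → Set
Admissible F G n k =
  Σ (Fin k → Copy F n) λ Fs → EdgeDisjoint Fs × ¬ Rainbowish Fs G

IsEx : Graph → Graph → ℕ → ℕ → Set
IsEx F G n k = Admissible F G n k × ((k' : ℕ) → Admissible F G n k' → k' ≤ k)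

IndependentOfSize : Graph → ℕ → Set
IndependentOfSize F a =
  Σ (Fin a → Fin (v F)) λ ι → Injective _≡_ _≡_ ι × ((i j : Fin a) → ¬ Adj F (ι i) (ι j))

IsAlpha : Graph → ℕ → Set
IsAlpha F a = IndependentOfSize F a × ((a' : ℕ) → IndependentOfSize F a' → a' ≤ a)

Packs : Graph → ℕ → ℕ → Set
Packs F m q = Σ (Fin m → Copy F q) λ Fs → EdgeDisjoint Fs

IsMinPack : Graph → ℕ → ℕ → Set
IsMinPack F m q = Packs F m q × ((q' : ℕ) → q' < q → ¬ Packs F m q')

-- floor division on ℕ (divisor 0 gives 0; only used with positive divisors)
_div_ : ℕ → ℕ → ℕ
m div zero = 0
m div suc d = m / suc d

-- Upper half of (i): two copies sharing a vertex w, together with an edge of each at w, form a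
-- P₃ whose edges lie in distinct copies; so the copies are vertex-disjoint and ex·v(F) ≤ n.
-- Lower half of (i) and (iii): split K_n into ⌊n/q⌋ disjoint blocks of q vertices, each carrying
-- t - 2 edge-disjoint copies of F.  Consecutive edges of a path share a vertex, so a path with
-- edges in distinct copies stays in one block and has at most t - 2 edges.
-- (ii): take copies of F that share the image of an independent set of size α(F) and are
-- otherwise disjoint.  In a P₄ with edges in three distinct copies, both ends of the middle edge
-- are shared with another copy, hence lie in the independent set: a contradiction.
module Submission where

open import Defs
open import Data.Nat using (ℕ; zero; suc; _+_; _*_; _∸_; _≤_; _<_; _≥_; z≤n; s≤s)
import Data.Nat.Properties as ℕ
import Data.Nat.DivMod as ℕ
open import Data.Nat.Coprimality using (Coprime; 1-coprimeTo)
import Data.Nat.Coprimality as Coprime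
open import Data.Fin using (Fin; zero; suc; toℕ; inject₁; inject≤; combine; remQuot; join; splitAt)
import Data.Fin.Properties as Fin
open import Data.Integer using (+_; +[1+_])
import Data.Integer as ℤ
import Data.Integer.Properties as ℤ
open import Data.Rational using (ℚ; mkℚ; toℚᵘ; Positive)
import Data.Rational as ℚ
import Data.Rational.Properties as ℚ
open import Data.Rational.Unnormalised using (mkℚᵘ)
import Data.Rational.Unnormalised as ℚᵘ
import Data.Rational.Unnormalised.Properties as ℚᵘ
open import Data.List using (List; []; _∷_; length; filter; allFin; lookup)
import Data.List.Properties as List
open import Data.List.Membership.Propositional using (_∈_)
open import Data.List.Membership.Propositional.Properties using (∈-filter⁺; ∈-allFin)
import Data.List.Relation.Unary.Any as Any
open import Data.List.Relation.Unary.Any.Properties using (lookup-index)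
open import Data.Product using (Σ; Σ-syntax; _×_; _,_; proj₁; proj₂; uncurry)
open import Data.Sum using (_⊎_; inj₁; inj₂)
open import Data.Sum.Properties using (inj₂-injective)
open import Data.Empty using (⊥; ⊥-elim)
open import Function using (_∘_; id)
open import Function.Definitions using (Injective)
open import Relation.Nullary using (¬_; yes; no; Dec; ¬?)
open import Relation.Unary using (Decidable)
open import Relation.Binary.PropositionalEquality

SamePair-sym : ∀ {n} {a b c d : Fin n} → SamePair a b c d → SamePair c d a b
SamePair-sym (inj₁ (refl , refl)) = inj₁ (refl , refl)
SamePair-sym (inj₂ (refl , refl)) = inj₂ (refl , refl)

SamePair-trans : ∀ {n} {a b c d e f : Fin n} → SamePair a b c d → SamePair c d e f → SamePair a b e f
SamePair-trans (inj₁ (refl , refl)) q = q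
SamePair-trans (inj₂ (refl , refl)) (inj₁ (refl , refl)) = inj₂ (refl , refl)
SamePair-trans (inj₂ (refl , refl)) (inj₂ (refl , refl)) = inj₁ (refl , refl)

SamePair-map : ∀ {m n} (f : Fin m → Fin n) {a b c d : Fin m} →
  SamePair a b c d → SamePair (f a) (f b) (f c) (f d)
SamePair-map f (inj₁ (refl , refl)) = inj₁ (refl , refl)
SamePair-map f (inj₂ (refl , refl)) = inj₂ (refl , refl)

module _ {F : Graph} {n : ℕ} where

  EdgeIn-sym : (C : Copy F n) {a b : Fin n} → EdgeIn C a b → EdgeIn C b a
  EdgeIn-sym C (x , y , xy , refl , refl) = y , x , symm F xy , refl , refl

  EdgeIn-resp-SamePair : (C : Copy F n) {a b c d : Fin n} → SamePair a b c d → EdgeIn C a b → EdgeIn C c d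
  EdgeIn-resp-SamePair C (inj₁ (refl , refl)) ab = ab
  EdgeIn-resp-SamePair C (inj₂ (refl , refl)) ab = EdgeIn-sym C ab

  EdgeIn⇒≢ : (C : Copy F n) {a b : Fin n} → EdgeIn C a b → a ≢ b
  EdgeIn⇒≢ C (x , y , xy , refl , refl) a≡b = irrefl F (subst (Adj F x) (sym (inj C a≡b)) xy)

  _∈V_ : Fin n → Copy F n → Set
  a ∈V C = Σ[ x ∈ Fin (v F) ] emb C x ≡ a

  EdgeIn⇒∈Vˡ : (C : Copy F n) {a b : Fin n} → EdgeIn C a b → a ∈V C
  EdgeIn⇒∈Vˡ C (x , _ , _ , ax , _) = x , ax

  EdgeIn⇒∈Vʳ : (C : Copy F n) {a b : Fin n} → EdgeIn C a b → b ∈V C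
  EdgeIn⇒∈Vʳ C (_ , y , _ , _ , by) = y , by

  VertexDisjoint : ∀ {k} → (Fin k → Copy F n) → Set
  VertexDisjoint Fs = ∀ {c c′ a} → a ∈V Fs c → a ∈V Fs c′ → c ≡ c′

  EdgeDisjoint⇒unique : ∀ {k} (Fs : Fin k → Copy F n) → EdgeDisjoint Fs →
    ∀ {i j a b} → EdgeIn (Fs i) a b → EdgeIn (Fs j) a b → i ≡ j
  EdgeDisjoint⇒unique Fs disjoint {i} {j} ab ab′ with i Fin.≟ j
  ... | yes i≡j = i≡j
  ... | no i≢j = ⊥-elim (disjoint i j i≢j _ _ ab ab′)

remQuot-injective : ∀ {m} n {i j : Fin (m * n)} → remQuot {m} n i ≡ remQuot n j → i ≡ j
remQuot-injective {m} n {i} {j} same = begin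
  i                              ≡⟨ Fin.combine-remQuot {m} n i ⟨
  uncurry combine (remQuot {m} n i) ≡⟨ cong (uncurry combine) same ⟩
  uncurry combine (remQuot {m} n j) ≡⟨ Fin.combine-remQuot {m} n j ⟩
  j                              ∎
  where open ≡-Reasoning

join-injective : ∀ m n {i j : Fin m ⊎ Fin n} → join m n i ≡ join m n j → i ≡ j
join-injective m n {i} {j} same = begin
  i                      ≡⟨ Fin.splitAt-join m n i ⟨
  splitAt m (join m n i) ≡⟨ cong (splitAt m) same ⟩
  splitAt m (join m n j) ≡⟨ Fin.splitAt-join m n j ⟩
  j                      ∎
  where open ≡-Reasoning

inject₁≢suc : ∀ {l} {i j : Fin l} → inject₁ i ≡ suc j → suc i ≢ inject₁ j
inject₁≢suc {i = suc i} {suc j} p q = inject₁≢suc (Fin.suc-injective p) (Fin.suc-injective q)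

consecutive≡⇒constant : ∀ {l} {B : Set} (f : Fin (suc l) → B) →
  ((i : Fin l) → f (inject₁ i) ≡ f (suc i)) → (i : Fin (suc l)) → f i ≡ f zero
consecutive≡⇒constant f step zero = refl
consecutive≡⇒constant {suc l} f step (suc i) =
  trans (consecutive≡⇒constant (f ∘ suc) (step ∘ suc) i) (sym (step zero))

PathAdj-edge : ∀ {l} (e : Fin l) → PathAdj (suc l) (inject₁ e) (suc e)
PathAdj-edge e = inj₁ (cong suc (Fin.toℕ-inject₁ e))

successor⇒edge : ∀ {l} (x y : Fin (suc l)) → suc (toℕ x) ≡ toℕ y →
  Σ[ e ∈ Fin l ] x ≡ inject₁ e × y ≡ suc e
successor⇒edge x (suc e) 1+x≡y =
  e , Fin.toℕ-injective (trans (ℕ.suc-injective 1+x≡y) (sym (Fin.toℕ-inject₁ e))) , refl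

PathAdj⇒edge : ∀ {l} {x y : Fin (suc l)} → PathAdj (suc l) x y →
  Σ[ e ∈ Fin l ] SamePair x y (inject₁ e) (suc e)
PathAdj⇒edge {x = x} {y} (inj₁ 1+x≡y) with successor⇒edge x y 1+x≡y
... | e , refl , refl = e , inj₁ (refl , refl)
PathAdj⇒edge {x = x} {y} (inj₂ 1+y≡x) with successor⇒edge y x 1+y≡x
... | e , refl , refl = e , inj₂ (refl , refl)

path₃ : ∀ {n} {u w u′ : Fin n} → u ≢ w → w ≢ u′ → u ≢ u′ → Copy (P 3) n
path₃ {n} {u} {w} {u′} u≢w w≢u′ u≢u′ = record { emb = vertex ; inj = injective }
  where
  vertex : Fin 3 → Fin n
  vertex zero = u
  vertex (suc zero) = w
  vertex (suc (suc zero)) = u′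
  injective : Injective _≡_ _≡_ vertex
  injective {zero} {zero} _ = refl
  injective {zero} {suc zero} p = ⊥-elim (u≢w p)
  injective {zero} {suc (suc zero)} p = ⊥-elim (u≢u′ p)
  injective {suc zero} {zero} p = ⊥-elim (u≢w (sym p))
  injective {suc zero} {suc zero} _ = refl
  injective {suc zero} {suc (suc zero)} p = ⊥-elim (w≢u′ p)
  injective {suc (suc zero)} {zero} p = ⊥-elim (u≢u′ (sym p))
  injective {suc (suc zero)} {suc zero} p = ⊥-elim (w≢u′ (sym p))
  injective {suc (suc zero)} {suc (suc zero)} _ = refl

record RainbowPath {F : Graph} {n k : ℕ} (Fs : Fin k → Copy F n) (l : ℕ) : Set where
  field
    path             : Copy (P (suc l)) n
    colour           : Fin l → Fin k
    colour-injective : Injective _≡_ _≡_ colour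
    colour-edge      : (e : Fin l) → EdgeIn (Fs (colour e)) (emb path (inject₁ e)) (emb path (suc e))

module _ {F : Graph} {n k : ℕ} {Fs : Fin k → Copy F n} where

  Rainbowish⇒RainbowPath : ∀ {l} → Rainbowish Fs (P (suc l)) → RainbowPath Fs l
  Rainbowish⇒RainbowPath {l} (H , edges , atMostOne) = record
    { path = H
    ; colour = colour
    ; colour-injective = colour-injective
    ; colour-edge = colour-edge
    }
    where
    colour : Fin l → Fin k
    colour e = proj₁ (edges _ _ (PathAdj-edge e))
    colour-edge : (e : Fin l) → EdgeIn (Fs (colour e)) (emb H (inject₁ e)) (emb H (suc e))
    colour-edge e = proj₂ (edges _ _ (PathAdj-edge e))
    colour-injective : Injective _≡_ _≡_ colour
    colour-injective {e} {e′} same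
      with atMostOne (colour e) _ _ _ _ (PathAdj-edge e) (PathAdj-edge e′)
             (colour-edge e) (subst (λ c → EdgeIn (Fs c) _ _) (sym same) (colour-edge e′))
    ... | inj₁ (p , _) = Fin.inject₁-injective (inj H p)
    ... | inj₂ (p , q) = ⊥-elim (inject₁≢suc (inj H p) (inj H q))

  RainbowPath⇒Rainbowish : ∀ {l} → EdgeDisjoint Fs → RainbowPath Fs l → Rainbowish Fs (P (suc l))
  RainbowPath⇒Rainbowish {l} disjoint rp = path , edges , atMostOne
    where
    open RainbowPath rp
    onPath : ∀ {x y x′ y′} → SamePair x y x′ y′ →
      SamePair (emb path x) (emb path y) (emb path x′) (emb path y′)
    onPath = SamePair-map (emb path)
    edges : (x y : Fin (suc l)) → PathAdj (suc l) x y → Σ[ i ∈ Fin k ] EdgeIn (Fs i) (emb path x) (emb path y)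
    edges x y xy with PathAdj⇒edge xy
    ... | e , xy≈e = colour e , EdgeIn-resp-SamePair (Fs _) (SamePair-sym (onPath xy≈e)) (colour-edge e)
    colour-unique : ∀ {i x y} e → SamePair x y (inject₁ e) (suc e) → EdgeIn (Fs i) (emb path x) (emb path y) →
      i ≡ colour e
    colour-unique e xy≈e xyᵢ =
      EdgeDisjoint⇒unique Fs disjoint (EdgeIn-resp-SamePair (Fs _) (onPath xy≈e) xyᵢ) (colour-edge e)
    atMostOne : (i : Fin k) (x y x′ y′ : Fin (suc l)) → PathAdj (suc l) x y → PathAdj (suc l) x′ y′ →
      EdgeIn (Fs i) (emb path x) (emb path y) → EdgeIn (Fs i) (emb path x′) (emb path y′) →
      SamePair (emb path x) (emb path y) (emb path x′) (emb path y′)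
    atMostOne i x y x′ y′ xy x′y′ xyᵢ x′y′ᵢ with PathAdj⇒edge xy | PathAdj⇒edge x′y′
    ... | e , xy≈e | e′ , x′y′≈e′
      with colour-injective (trans (sym (colour-unique e xy≈e xyᵢ)) (colour-unique e′ x′y′≈e′ x′y′ᵢ))
    ... | refl = SamePair-trans (onPath xy≈e) (SamePair-sym (onPath x′y′≈e′))

  RainbowPath-length≤blockSize : ∀ {l b m} (block : Fin k → Fin b) (index : Fin k → Fin m) →
    (∀ {c c′} → block c ≡ block c′ → index c ≡ index c′ → c ≡ c′) →
    (∀ {c c′ a} → a ∈V Fs c → a ∈V Fs c′ → block c ≡ block c′) →
    RainbowPath Fs l → l ≤ m
  RainbowPath-length≤blockSize {zero} _ _ _ _ _ = z≤n
  RainbowPath-length≤blockSize {suc l} block index blockwise-injective separated rp =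
    Fin.injective⇒≤ index∘colour-injective
    where
    open RainbowPath rp
    same-block : (e : Fin (suc l)) → block (colour e) ≡ block (colour zero)
    same-block = consecutive≡⇒constant (block ∘ colour) λ e →
      separated (EdgeIn⇒∈Vʳ (Fs _) (colour-edge (inject₁ e))) (EdgeIn⇒∈Vˡ (Fs _) (colour-edge (suc e)))
    index∘colour-injective : Injective _≡_ _≡_ (index ∘ colour)
    index∘colour-injective {e} {e′} same-index =
      colour-injective (blockwise-injective (trans (same-block e) (sym (same-block e′))) same-index)

  twoEdges⇒RainbowPath : EdgeDisjoint Fs → ∀ {c c′ u w u′} → c ≢ c′ →
    EdgeIn (Fs c) u w → EdgeIn (Fs c′) w u′ → RainbowPath Fs 2
  twoEdges⇒RainbowPath disjoint {c} {c′} {u} {w} {u′} c≢c′ uw wu′ = record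
    { path = path₃ (EdgeIn⇒≢ (Fs c) uw) (EdgeIn⇒≢ (Fs c′) wu′) u≢u′
    ; colour = colour
    ; colour-injective = colour-injective
    ; colour-edge = λ { zero → uw ; (suc zero) → wu′ }
    }
    where
    u≢u′ : u ≢ u′
    u≢u′ refl = disjoint c c′ c≢c′ u w uw (EdgeIn-sym (Fs c′) wu′)
    colour : Fin 2 → Fin k
    colour zero = c
    colour (suc zero) = c′
    colour-injective : Injective _≡_ _≡_ colour
    colour-injective {zero} {zero} _ = refl
    colour-injective {zero} {suc zero} p = ⊥-elim (c≢c′ p)
    colour-injective {suc zero} {zero} p = ⊥-elim (c≢c′ (sym p))
    colour-injective {suc zero} {suc zero} _ = refl

  sharedVertex⇒RainbowPath : EdgeDisjoint Fs → NoIsolated F →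
    ∀ {c c′ a} → c ≢ c′ → a ∈V Fs c → a ∈V Fs c′ → RainbowPath Fs 2
  sharedVertex⇒RainbowPath disjoint noIsolated c≢c′ (x , refl) (x′ , same) =
    twoEdges⇒RainbowPath disjoint c≢c′ (y , x , symm F xy , refl , refl) (x′ , y′ , x′y′ , same , refl)
    where
    y = proj₁ (noIsolated x)
    xy = proj₂ (noIsolated x)
    y′ = proj₁ (noIsolated x′)
    x′y′ = proj₂ (noIsolated x′)

  VertexDisjoint⇒≤ : VertexDisjoint Fs → k * v F ≤ n
  VertexDisjoint⇒≤ vertexDisjoint =
    Fin.injective⇒≤ {f = vertex ∘ remQuot {k} (v F)} (remQuot-injective {k} (v F) ∘ vertex-injective)
    where
    vertex : Fin k × Fin (v F) → Fin n
    vertex (c , x) = emb (Fs c) x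
    vertex-injective : Injective _≡_ _≡_ vertex
    vertex-injective {c , x} {c′ , x′} same with vertexDisjoint (x , refl) (x′ , sym same)
    ... | refl = cong (c ,_) (inj (Fs c) same)

Admissible-P₃⇒≤ : ∀ {F n k} → NoIsolated F → Admissible F (P 3) n k → k * v F ≤ n
Admissible-P₃⇒≤ noIsolated (Fs , disjoint , noRainbow) = VertexDisjoint⇒≤ {Fs = Fs} vertexDisjoint
  where
  vertexDisjoint : VertexDisjoint Fs
  vertexDisjoint {c} {c′} ac ac′ with c Fin.≟ c′
  ... | yes c≡c′ = c≡c′
  ... | no c≢c′ = ⊥-elim (noRainbow (RainbowPath⇒Rainbowish disjoint
                    (sharedVertex⇒RainbowPath {Fs = Fs} disjoint noIsolated c≢c′ ac ac′)))

module BlockFamily {F : Graph} {m q : ℕ} (pack : Fin m → Copy F q) (disjoint : EdgeDisjoint pack)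
                   {b n : ℕ} (fits : b * q ≤ n) where

  blockVertex : Fin b → Fin q → Fin n
  blockVertex β r = inject≤ (combine β r) fits

  blockVertex-injective : ∀ {β β′ r r′} → blockVertex β r ≡ blockVertex β′ r′ → β ≡ β′ × r ≡ r′
  blockVertex-injective {β} {β′} {r} {r′} same =
    Fin.combine-injective β r β′ r′ (Fin.inject≤-injective fits fits _ _ same)

  block : Fin (b * m) → Fin b
  block c = proj₁ (remQuot {b} m c)

  index : Fin (b * m) → Fin m
  index c = proj₂ (remQuot {b} m c)

  block-index-injective : ∀ {c c′} → block c ≡ block c′ → index c ≡ index c′ → c ≡ c′
  block-index-injective same-block same-index = remQuot-injective m (cong₂ _,_ same-block same-index)

  family : Fin (b * m) → Copy F n
  family c = record
    { emb = blockVertex (block c) ∘ emb (pack (index c))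
    ; inj = inj (pack (index c)) ∘ proj₂ ∘ blockVertex-injective
    }

  separated : ∀ {c c′ a} → a ∈V family c → a ∈V family c′ → block c ≡ block c′
  separated (_ , refl) (_ , same) = proj₁ (blockVertex-injective (sym same))

  edgeDisjoint : EdgeDisjoint family
  edgeDisjoint c c′ c≢c′ _ _ (x , y , xy , refl , refl) (x′ , y′ , x′y′ , same₁ , same₂)
    with blockVertex-injective same₁ | blockVertex-injective same₂
  ... | same-block , sameˣ | _ , sameʸ with index c Fin.≟ index c′
  ... | yes same-index = c≢c′ (block-index-injective (sym same-block) same-index)
  ... | no index≢ = disjoint (index c) (index c′) index≢ _ _
                      (x , y , xy , refl , refl) (x′ , y′ , x′y′ , sameˣ , sameʸ)

  noLongRainbowPath : RainbowPath family (suc m) → ⊥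
  noLongRainbowPath = ℕ.1+n≰n ∘ RainbowPath-length≤blockSize block index block-index-injective separated

Packs⇒Admissible : ∀ {F m q b n} → Packs F m q → b * q ≤ n → Admissible F (P (suc (suc m))) n (b * m)
Packs⇒Admissible {b = b} (pack , disjoint) fits =
  family , edgeDisjoint , noLongRainbowPath ∘ Rainbowish⇒RainbowPath
  where open BlockFamily pack disjoint {b} fits

length-filter+length-filter-¬ : ∀ {A : Set} {Q : A → Set} (Q? : Decidable Q) (xs : List A) →
  length (filter Q? xs) + length (filter (¬? ∘ Q?) xs) ≡ length xs
length-filter+length-filter-¬ Q? [] = refl
length-filter+length-filter-¬ Q? (x ∷ xs) with Q? x
... | yes _ = cong suc (length-filter+length-filter-¬ Q? xs)
... | no _ = trans (ℕ.+-suc _ _) (cong suc (length-filter+length-filter-¬ Q? xs))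

index-injective : ∀ {A : Set} {xs : List A} {x y : A} (x∈ : x ∈ xs) (y∈ : y ∈ xs) →
  Any.index x∈ ≡ Any.index y∈ → x ≡ y
index-injective {xs = xs} x∈ y∈ same =
  trans (lookup-index x∈) (trans (cong (lookup xs) same) (sym (lookup-index y∈)))

module ComplementRank {v a : ℕ} (ι : Fin a → Fin v) (ι-injective : Injective _≡_ _≡_ ι) where

  InImage : Fin v → Set
  InImage x = Σ[ j ∈ Fin a ] ι j ≡ x

  inImage? : Decidable InImage
  inImage? x = Fin.any? (λ j → ι j Fin.≟ x)

  private
    inside outside : List (Fin v)
    inside = filter inImage? (allFin v)
    outside = filter (¬? ∘ inImage?) (allFin v)

    ∈inside : (j : Fin a) → ι j ∈ inside
    ∈inside j = ∈-filter⁺ inImage? (∈-allFin (ι j)) (j , refl)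

    ∈outside : (x : Fin v) → ¬ InImage x → x ∈ outside
    ∈outside x x∉ = ∈-filter⁺ (¬? ∘ inImage?) (∈-allFin x) x∉

    a≤|inside| : a ≤ length inside
    a≤|inside| = Fin.injective⇒≤ {f = Any.index ∘ ∈inside}
      (ι-injective ∘ index-injective (∈inside _) (∈inside _))

    |outside|≤v∸a : length outside ≤ v ∸ a
    |outside|≤v∸a = ℕ.m+n≤o⇒m≤o∸n (length outside) (begin
      length outside + a              ≡⟨ ℕ.+-comm (length outside) a ⟩
      a + length outside              ≤⟨ ℕ.+-monoˡ-≤ (length outside) a≤|inside| ⟩
      length inside + length outside  ≡⟨ length-filter+length-filter-¬ inImage? (allFin v) ⟩
      length (allFin v)               ≡⟨ List.length-tabulate id ⟩
      v                               ∎)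
      where open ℕ.≤-Reasoning

  rank : (x : Fin v) → ¬ InImage x → Fin (v ∸ a)
  rank x x∉ = inject≤ (Any.index (∈outside x x∉)) |outside|≤v∸a

  rank-injective : ∀ {x y} (x∉ : ¬ InImage x) (y∉ : ¬ InImage y) → rank x x∉ ≡ rank y y∉ → x ≡ y
  rank-injective x∉ y∉ same =
    index-injective (∈outside _ x∉) (∈outside _ y∉)
      (Fin.inject≤-injective |outside|≤v∸a |outside|≤v∸a _ _ same)

module Sunflower {F : Graph} {a : ℕ} (core : IndependentOfSize F a) {b n : ℕ}
                 (fits : a + b * (v F ∸ a) ≤ n) where

  open ComplementRank (proj₁ core) (proj₁ (proj₂ core))

  InImage⇒¬Adj : ∀ {x y} → InImage x → InImage y → ¬ Adj F x y
  InImage⇒¬Adj (j , refl) (j′ , refl) = proj₂ (proj₂ core) j j′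

  position : Fin b → (x : Fin (v F)) → Dec (InImage x) → Fin a ⊎ Fin (b * (v F ∸ a))
  position c x (yes (j , _)) = inj₁ j
  position c x (no x∉) = inj₂ (combine c (rank x x∉))

  same-position : ∀ {c c′ x x′} dx dx′ → position c x dx ≡ position c′ x′ dx′ →
    x ≡ x′ × (InImage x ⊎ c ≡ c′)
  same-position (yes (j , refl)) (yes (j′ , refl)) refl = refl , inj₁ (j , refl)
  same-position {c} {c′} (no x∉) (no x′∉) same with Fin.combine-injective c _ c′ _ (inj₂-injective same)
  ... | c≡c′ , same-rank = rank-injective x∉ x′∉ same-rank , inj₂ c≡c′

  vertex : Fin b → Fin (v F) → Fin n
  vertex c x = inject≤ (join a _ (position c x (inImage? x))) fits

  same-vertex : ∀ {c c′ x x′} → vertex c x ≡ vertex c′ x′ → x ≡ x′ × (InImage x ⊎ c ≡ c′)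
  same-vertex {x = x} {x′} same =
    same-position (inImage? x) (inImage? x′) (join-injective a _ (Fin.inject≤-injective fits fits _ _ same))

  petal : Fin b → Copy F n
  petal c = record { emb = vertex c ; inj = proj₁ ∘ same-vertex }

  shared⇒InImage : ∀ {c c′ x x′} → c ≢ c′ → vertex c x ≡ vertex c′ x′ → InImage x
  shared⇒InImage c≢c′ same with same-vertex same
  ... | _ , inj₁ x∈ = x∈
  ... | _ , inj₂ c≡c′ = ⊥-elim (c≢c′ c≡c′)

  ¬sharedEdge : ∀ {c c₁ c₂ u w} → EdgeIn (petal c) u w → c ≢ c₁ → c ≢ c₂ →
    u ∈V petal c₁ → w ∈V petal c₂ → ⊥
  ¬sharedEdge (x , y , xy , refl , refl) c≢c₁ c≢c₂ (_ , ux) (_ , wy) =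
    InImage⇒¬Adj (shared⇒InImage c≢c₁ (sym ux)) (shared⇒InImage c≢c₂ (sym wy)) xy

  edgeDisjoint : EdgeDisjoint petal
  edgeDisjoint c c′ c≢c′ u w uw uw′ =
    ¬sharedEdge uw c≢c′ c≢c′ (EdgeIn⇒∈Vˡ (petal c′) uw′) (EdgeIn⇒∈Vʳ (petal c′) uw′)

  noRainbowP₄ : RainbowPath petal 3 → ⊥
  noRainbowP₄ rp = ¬sharedEdge (colour-edge e₁) (e₁≢ λ ()) (e₁≢ λ ())
    (EdgeIn⇒∈Vʳ (petal _) (colour-edge e₀)) (EdgeIn⇒∈Vˡ (petal _) (colour-edge e₂))
    where
    open RainbowPath rp
    e₀ e₁ e₂ : Fin 3
    e₀ = zero
    e₁ = suc zero
    e₂ = suc (suc zero)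
    e₁≢ : ∀ {e} → e₁ ≢ e → colour e₁ ≢ colour e
    e₁≢ e₁≢e = e₁≢e ∘ colour-injective

IndependentOfSize⇒Admissible : ∀ {F a b n} → IndependentOfSize F a → a + b * (v F ∸ a) ≤ n →
  Admissible F (P 4) n b
IndependentOfSize⇒Admissible {F} {b = b} core fits =
  petal , edgeDisjoint , noRainbowP₄ ∘ Rainbowish⇒RainbowPath
  where open Sunflower {F} core {b} fits

div-*-≤ : ∀ m d → (m div d) * d ≤ m
div-*-≤ m zero = z≤n
div-*-≤ m (suc d) = ℕ.m/n*n≤m m (suc d)

div≤⇒∸*≤ : ∀ {m d k} → 0 < d → m div d ≤ k → m ∸ k * d ≤ d
div≤⇒∸*≤ {m} {suc d} {k} _ m/d≤k = ℕ.m≤n+o⇒m∸n≤o m (k * suc d) (begin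
  m                                   ≡⟨ ℕ.m≡m%n+[m/n]*n m (suc d) ⟩
  m ℕ.% suc d + m ℕ./ suc d * suc d   ≤⟨ ℕ.+-mono-≤ (ℕ.<⇒≤ (ℕ.m%n<n m (suc d))) (ℕ.*-monoˡ-≤ (suc d) m/d≤k) ⟩
  suc d + k * suc d                   ≡⟨ ℕ.+-comm (suc d) (k * suc d) ⟩
  k * suc d + suc d                   ∎)
  where open ℕ.≤-Reasoning

coprime-1 : ∀ m → Coprime m 1
coprime-1 m = Coprime.sym (1-coprimeTo m)

ℕ/1≡mkℚ : ∀ m → (+ m) ℚ./ 1 ≡ mkℚ (+ m) 0 (coprime-1 m)
ℕ/1≡mkℚ m = ℚ.normalize-coprime (coprime-1 m)

-- Cross-multiplied, this is ∣K - n∣ (d + 1) ≤ (p + 1) n.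
∣K-n∣≤ε*nᵘ : ∀ {K n p d} → K ≤ n → (n ∸ K) * suc d ≤ suc p * n →
  ℚᵘ.∣ mkℚᵘ (+ K) 0 ℚᵘ.- mkℚᵘ (+ n) 0 ∣ ℚᵘ.≤ mkℚᵘ +[1+ p ] d ℚᵘ.* mkℚᵘ (+ n) 0
∣K-n∣≤ε*nᵘ {K} {n} {p} {d} K≤n bound = ℚᵘ.*≤* (subst₂ ℤ._≤_ (sym lhs) (sym rhs) (ℤ.+≤+ bound′))
  where
  ∣K-n∣ : ℤ.∣ + K ℤ.* + 1 ℤ.+ (ℤ.- + n) ℤ.* + 1 ∣ ≡ n ∸ K
  ∣K-n∣ = trans (cong ℤ.∣_∣ (trans (cong₂ ℤ._+_ (ℤ.*-identityʳ (+ K)) (ℤ.*-identityʳ (ℤ.- + n))) (ℤ.m-n≡m⊖n K n)))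
                (ℤ.∣⊖∣-≤ K≤n)
  lhs : + ℤ.∣ + K ℤ.* + 1 ℤ.+ (ℤ.- + n) ℤ.* + 1 ∣ ℤ.* + suc (d * 1) ≡ + ((n ∸ K) * suc (d * 1))
  lhs = trans (cong (λ z → + z ℤ.* + suc (d * 1)) ∣K-n∣) (sym (ℤ.pos-* (n ∸ K) (suc (d * 1))))
  rhs : (+[1+ p ] ℤ.* + n) ℤ.* + 1 ≡ + (suc p * n)
  rhs = trans (ℤ.*-identityʳ _) (sym (ℤ.pos-* (suc p) n))
  bound′ : (n ∸ K) * suc (d * 1) ≤ suc p * n
  bound′ = subst (λ z → (n ∸ K) * suc z ≤ suc p * n) (sym (ℕ.*-identityʳ d)) bound

∣K-n∣≤ε*n : ∀ {K n p d} .(c : Coprime (suc p) (suc d)) → K ≤ n → (n ∸ K) * suc d ≤ suc p * n →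
  ℚ.∣ (+ K) ℚ./ 1 ℚ.- (+ n) ℚ./ 1 ∣ ℚ.≤ mkℚ +[1+ p ] d c ℚ.* ((+ n) ℚ./ 1)
∣K-n∣≤ε*n {K} {n} {p} {d} c K≤n bound rewrite ℕ/1≡mkℚ K | ℕ/1≡mkℚ n =
  ℚ.toℚᵘ-cancel-≤ (ℚᵘ.≤-respˡ-≃ (ℚᵘ.≃-sym lhs) (ℚᵘ.≤-respʳ-≃ (ℚᵘ.≃-sym rhs) (∣K-n∣≤ε*nᵘ {p = p} {d} K≤n bound)))
  where
  K′ = mkℚ (+ K) 0 (coprime-1 K)
  n′ = mkℚ (+ n) 0 (coprime-1 n)
  lhs : toℚᵘ ℚ.∣ K′ ℚ.- n′ ∣ ℚᵘ.≃ ℚᵘ.∣ mkℚᵘ (+ K) 0 ℚᵘ.- mkℚᵘ (+ n) 0 ∣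
  lhs = ℚᵘ.≃-trans (ℚ.toℚᵘ-homo-∣-∣ (K′ ℚ.- n′))
          (ℚᵘ.∣-∣-cong (ℚᵘ.≃-trans (ℚ.toℚᵘ-homo-+ K′ (ℚ.- n′)) (ℚᵘ.+-congʳ (toℚᵘ K′) (ℚ.toℚᵘ-homo‿- n′))))
  rhs : toℚᵘ (mkℚ +[1+ p ] d c ℚ.* n′) ℚᵘ.≃ mkℚᵘ +[1+ p ] d ℚᵘ.* mkℚᵘ (+ n) 0
  rhs = ℚ.toℚᵘ-homo-* (mkℚ +[1+ p ] d c) n′

identityPacking : (F : Graph) → Packs F 1 (v F)
identityPacking F = (λ _ → record { emb = id ; inj = id }) , λ { zero zero 0≢0 → ⊥-elim (0≢0 refl) }

ex-Pₜ-lower : ∀ {F m q n k} → Packs F m q → IsEx F (P (suc (suc m))) n k → (n div q) * m ≤ k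
ex-Pₜ-lower {q = q} {n} pack (_ , maximal) = maximal _ (Packs⇒Admissible {b = n div q} pack (div-*-≤ n q))

ex-P₄-lower : ∀ {F a n k} → IndependentOfSize F a → IsEx F (P 4) n k → (n ∸ a) div (v F ∸ a) ≤ k
ex-P₄-lower {F} {a} {n} core (_ , maximal) with a ℕ.≤? n
... | yes a≤n = maximal _ (IndependentOfSize⇒Admissible {b = (n ∸ a) div (v F ∸ a)} core fits)
  where
  fits : a + ((n ∸ a) div (v F ∸ a)) * (v F ∸ a) ≤ n
  fits = subst (a + ((n ∸ a) div (v F ∸ a)) * (v F ∸ a) ≤_) (ℕ.m+[n∸m]≡n a≤n)
           (ℕ.+-monoʳ-≤ a (div-*-≤ (n ∸ a) (v F ∸ a)))
... | no a≰n rewrite ℕ.m≤n⇒m∸n≡0 (ℕ.<⇒≤ (ℕ.≰⇒> a≰n)) = subst (_≤ _) (sym (0-div (v F ∸ a))) z≤n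
  where
  0-div : ∀ d → 0 div d ≡ 0
  0-div zero = refl
  0-div (suc d) = refl

ex-P₃-bounds : ∀ {F n k} → NonemptyGraph F → NoIsolated F → IsEx F (P 3) n k → k * v F ≤ n × n ∸ k * v F ≤ v F
ex-P₃-bounds {F} {n} {k} (x , _) noIsolated ex =
  Admissible-P₃⇒≤ noIsolated (proj₁ ex) ,
  div≤⇒∸*≤ (ℕ.≤-<-trans z≤n (Fin.toℕ<n x))
    (subst (_≤ k) (ℕ.*-identityʳ (n div v F)) (ex-Pₜ-lower (identityPacking F) ex))

ex-P₃-asymptotic : ∀ {F} → NonemptyGraph F → NoIsolated F →
  (ε : ℚ) → Positive ε → Σ ℕ λ N → (n : ℕ) → n ≥ N → (k : ℕ) → IsEx F (P 3) n k →
  ℚ.∣ (+ (k * v F)) ℚ./ 1 ℚ.- (+ n) ℚ./ 1 ∣ ℚ.≤ ε ℚ.* ((+ n) ℚ./ 1)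
ex-P₃-asymptotic {F} nonempty noIsolated (mkℚ +[1+ p ] d coprime) _ = v F * suc d , λ n N≤n k ex →
  let kv≤n , gap = ex-P₃-bounds nonempty noIsolated ex
  in ∣K-n∣≤ε*n coprime kv≤n (ℕ.≤-trans (ℕ.*-monoˡ-≤ (suc d) gap) (ℕ.≤-trans N≤n (ℕ.m≤m+n n (p * n))))

proposition4 : (F : Graph) → NonemptyGraph F → NoIsolated F →
    -- (i) ex_F(n,P_3) ~ n / v(F): for every ε > 0, eventually |ex·v(F) - n| ≤ ε·n
    ((ε : ℚ) → Positive ε → Σ ℕ λ N → (n : ℕ) → n ≥ N → (k : ℕ) → IsEx F (P 3) n k →
        ℚ.∣ (+ (k * v F)) ℚ./ 1 ℚ.- (+ n) ℚ./ 1 ∣ ℚ.≤ ε ℚ.* ((+ n) ℚ./ 1))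
    ×
    -- (ii) ex_F(n,P_4) ≥ ⌊(n - α(F)) / (v(F) - α(F))⌋
    ((n a k : ℕ) → IsAlpha F a → IsEx F (P 4) n k → k ≥ (n ∸ a) div (v F ∸ a))
    ×
    -- (iii) for t ≥ 3 and q minimal with t-2 edge-disjoint copies of F in K_q,
    --       ex_F(n,P_t) ≥ ⌊n/q⌋ (t-2)
    ((t : ℕ) → t ≥ 3 → (q : ℕ) → IsMinPack F (t ∸ 2) q →
        (n k : ℕ) → IsEx F (P t) n k → k ≥ (n div q) * (t ∸ 2))
proposition4 F nonempty noIsolated =
  ex-P₃-asymptotic nonempty noIsolated ,
  (λ n a k α → ex-P₄-lower (proj₁ α)) ,
  λ { (suc (suc m)) _ q minimal n k → ex-Pₜ-lower (proj₁ minimal) ; (suc zero) (s≤s ()) }
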